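{- For every integer $s\geq 1$, the number $n_s(G)$ of $s$-cliques of a graph is a weakly-feasible graph parameter; that is, for every connected graph $G$: (I) $n_s(G)\leq n_s(G[u\to v])$ for any vertices $u,v$ of $G$; and (II) $n_s(G)\leq n_s(G+e)$ for any new edge $e\notin E(G)$ with at least one endpoint in $V(G)$.
   Context: For a graph $G$ and vertices $x\neq y$, the Kelmans operation $G[x\to y]$ is the graph on $V(G)$ obtained by replacing every edge $wx$ with $w\in N_G(x)\setminus N_G[y]$ by the edge $wy$ (the vertices $x,y$ may or may not be adjacent). -}

module Defs where

open import Data.Nat using (ℕ; zero; suc; _≡ᵇ_)
open import Data.Bool using (Bool; true; false; _∧_; _∨_; not)
open import Data.Fin using (Fin; zero; suc; _≟_)
open import Data.Fin.Subset using (Subset; ∣_∣)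
open import Data.Vec using (Vec; []; _∷_; lookup)
open import Data.List using (List; []; _∷_; map; _++_; length; allFin)
open import Relation.Nullary.Decidable using (⌊_⌋)
open import Relation.Binary.PropositionalEquality using (_≡_)
open import Data.Empty using (⊥)

Adj : ℕ → Set
Adj n = Fin n → Fin n → Bool

record SimpleGraph (n : ℕ) : Set where
  field
    adj   : Adj n
    sym   : ∀ u v → adj u v ≡ adj v u
    loopless : ∀ u → adj u u ≡ false
open SimpleGraph public

data Walk {n : ℕ} (A : Adj n) : Fin n → Fin n → Set where
  here : ∀ {u} → Walk A u u
  step : ∀ {u w v} → A u w ≡ true → Walk A w v → Walk A u v

Connected : {n : ℕ} → SimpleGraph n → Set
Connected {zero} G = ⊥
Connected {suc n} G = ∀ u v → Walk (adj G) u v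

_==_ : {n : ℕ} → Fin n → Fin n → Bool
a == b = ⌊ a ≟ b ⌋

allSubsets : (n : ℕ) → List (Subset n)
allSubsets zero = [] ∷ []
allSubsets (suc n) = map (true ∷_) (allSubsets n) ++ map (false ∷_) (allSubsets n)

allᵇ : {A : Set} → (A → Bool) → List A → Bool
allᵇ p [] = true
allᵇ p (x ∷ xs) = p x ∧ allᵇ p xs

countᵇ : {A : Set} → (A → Bool) → List A → ℕ
countᵇ p [] = 0
countᵇ p (x ∷ xs) with p x
... | true = suc (countᵇ p xs)
... | false = countᵇ p xs

isCliqueᵇ : {n : ℕ} → ℕ → Adj n → Subset n → Bool
isCliqueᵇ {n} s A S =
  (∣ S ∣ ≡ᵇ s) ∧
  allᵇ (λ i → allᵇ (λ j → not (lookup S i ∧ lookup S j) ∨ (i == j) ∨ A i j) (allFin n)) (allFin n)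

numCliques : {n : ℕ} → ℕ → Adj n → ℕ
numCliques {n} s A = countᵇ (isCliqueᵇ s A) (allSubsets n)

-- Kelmans operation G[x → y]: every edge wx with w ∈ N(x) ∖ N[y] is replaced by wy.
-- moves w : w ∈ N(x) ∖ N[y].
kelmans : {n : ℕ} → SimpleGraph n → Fin n → Fin n → Adj n
kelmans G x y a b =
  (adj G a b ∧ not (((a == x) ∧ moves b) ∨ ((b == x) ∧ moves a)))
  ∨ ((a == y) ∧ moves b) ∨ ((b == y) ∧ moves a)
  where
  moves : _ → Bool
  moves w = adj G w x ∧ not (w == y) ∧ not (adj G w y)

addEdge : {n : ℕ} → SimpleGraph n → Fin n → Fin n → Adj n
addEdge G u v a b = adj G a b ∨ ((a == u) ∧ (b == v)) ∨ ((a == v) ∧ (b == u))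

-- G + uw where w is a new vertex (represented as zero; old vertex i becomes suc i).
addPendant : {n : ℕ} → SimpleGraph n → Fin n → Adj (suc n)
addPendant G u zero zero = false
addPendant G u zero (suc j) = j == u
addPendant G u (suc i) zero = i == u
addPendant G u (suc i) (suc j) = adj G i j

{-# OPTIONS --safe #-}
module Submission where

-- Adding an edge or a vertex only adds cliques. For the Kelmans operation K = G[x → y], call w
-- moving if it is a neighbour of x but not of y. A clique S of G that is not a clique of K must
-- contain x and a moving vertex w, so it misses y (as w ≁ y). Exchanging x and y turns S into a
-- clique of K that is not a clique of G (it contains w and y). Exchanging x and y is an
-- involution on vertex sets, so the cliques lost are matched injectively with cliques gained.

open import Defs
open import Data.Nat using (ℕ; zero; suc; _+_; _≤_; z≤n; s≤s)
open import Data.Fin using (Fin; zero; suc; _≟_)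
open import Data.Bool using (Bool; true; false; T; not; _∧_; _∨_)
open import Data.Product using (_×_; _,_; proj₁; proj₂)
open import Relation.Binary.PropositionalEquality using (_≡_; _≢_)

open import Function.Base using (_∘_)
open import Function.Bundles using (_⇔_; mk⇔; module Equivalence)
open import Data.Empty using (⊥-elim)
open import Data.Unit using (tt)
open import Data.Sum using (_⊎_; inj₁; inj₂; [_,_])
open import Data.Bool.Properties using (T-≡; T-not-≡; T-∧; T-∨; ∧-comm; ∨-comm)
open import Data.Nat.Properties using (≡ᵇ⇒≡; ≡⇒≡ᵇ; +-suc; +-mono-≤; ≤-refl; m≤n⇒m≤1+n; module ≤-Reasoning)
open import Data.Fin.Properties using (any?)
open import Data.Fin.Subset using (Subset; ∣_∣)
open import Data.Vec using (Vec; []; _∷_; lookup; tabulate; _[_]≔_)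
open import Data.Vec.Properties using (lookup∘update; lookup∘update′; tabulate∘lookup; tabulate-cong; ∷-injectiveʳ)
open import Data.List using (List; []; _∷_; map; _++_; length; filterᵇ; allFin)
open import Data.List.Membership.Propositional using (_∈_)
open import Data.List.Membership.Propositional.Properties using (∈-map⁺; ∈-map⁻; ∈-++⁺ˡ; ∈-++⁺ʳ; ∈-allFin)
open import Data.List.Membership.Propositional.Properties.WithK using (unique∧set⇒bag)
open import Data.List.Relation.Unary.Any using (here; there)
import Data.List.Relation.Unary.All as All
import Data.List.Relation.Unary.AllPairs as AllPairs
open import Data.List.Relation.Unary.Unique.Propositional using (Unique)
import Data.List.Relation.Unary.Unique.Propositional.Properties as Unique
open import Data.List.Relation.Binary.Permutation.Propositional using (_↭_)
open import Data.List.Relation.Binary.Permutation.Propositional.Properties using (filter-↭; ↭-length)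
open import Data.List.Relation.Binary.BagAndSetEquality using (∼bag⇒↭)
open import Relation.Nullary using (¬_; Dec; yes; no)
open import Relation.Nullary.Decidable using (T?; toWitness; fromWitness)
import Relation.Binary.PropositionalEquality as ≡
open ≡ using (refl; cong; cong₂; subst; module ≡-Reasoning)
open Equivalence using (to; from)

T-not : ∀ {b} → T (not b) ⇔ (¬ T b)
T-not {true}  = mk⇔ (λ ()) (λ ¬t → ¬t tt)
T-not {false} = mk⇔ (λ _ ()) (λ _ → tt)

module _ {A : Set} where

  countᵇ≡length∘filterᵇ : ∀ (p : A → Bool) xs → countᵇ p xs ≡ length (filterᵇ p xs)
  countᵇ≡length∘filterᵇ p [] = refl
  countᵇ≡length∘filterᵇ p (x ∷ xs) with p x
  ... | true  = cong suc (countᵇ≡length∘filterᵇ p xs)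
  ... | false = countᵇ≡length∘filterᵇ p xs

  countᵇ-↭ : ∀ (p : A → Bool) {xs ys} → xs ↭ ys → countᵇ p xs ≡ countᵇ p ys
  countᵇ-↭ p {xs} {ys} xs↭ys = begin
    countᵇ p xs                ≡⟨ countᵇ≡length∘filterᵇ p xs ⟩
    length (filterᵇ p xs)      ≡⟨ ↭-length (filter-↭ (T? ∘ p) xs↭ys) ⟩
    length (filterᵇ p ys)      ≡⟨ ≡.sym (countᵇ≡length∘filterᵇ p ys) ⟩
    countᵇ p ys                ∎
    where open ≡-Reasoning

  countᵇ-map : ∀ {B : Set} (p : B → Bool) (f : A → B) xs → countᵇ p (map f xs) ≡ countᵇ (p ∘ f) xs
  countᵇ-map p f [] = refl
  countᵇ-map p f (x ∷ xs) with p (f x)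
  ... | true  = cong suc (countᵇ-map p f xs)
  ... | false = countᵇ-map p f xs

  countᵇ-mono : ∀ {p q : A → Bool} → (∀ {a} → T (p a) → T (q a)) → ∀ xs → countᵇ p xs ≤ countᵇ q xs
  countᵇ-mono p⇒q [] = z≤n
  countᵇ-mono {p} {q} p⇒q (x ∷ xs) with p x in px | q x in qx
  ... | true  | true  = s≤s (countᵇ-mono p⇒q xs)
  ... | false | true  = m≤n⇒m≤1+n (countᵇ-mono p⇒q xs)
  ... | false | false = countᵇ-mono p⇒q xs
  ... | true  | false = ⊥-elim (subst T qx (p⇒q (from T-≡ px)))

  countᵇ-++ʳ : ∀ (p : A → Bool) xs ys → countᵇ p ys ≤ countᵇ p (xs ++ ys)
  countᵇ-++ʳ p [] ys = ≤-refl
  countᵇ-++ʳ p (x ∷ xs) ys with p x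
  ... | true  = m≤n⇒m≤1+n (countᵇ-++ʳ p xs ys)
  ... | false = countᵇ-++ʳ p xs ys

  countᵇ-partition : ∀ (p q : A → Bool) xs →
    countᵇ p xs ≡ countᵇ (λ a → p a ∧ q a) xs + countᵇ (λ a → p a ∧ not (q a)) xs
  countᵇ-partition p q [] = refl
  countᵇ-partition p q (x ∷ xs) with p x | q x
  ... | true  | true  = cong suc (countᵇ-partition p q xs)
  ... | true  | false = ≡.trans (cong suc (countᵇ-partition p q xs)) (≡.sym (+-suc _ _))
  ... | false | _     = countᵇ-partition p q xs

  module _ {σ : A → A} (σ-involutive : ∀ a → σ (σ a) ≡ a)
           {xs : List A} (xs-unique : Unique xs) (xs-complete : ∀ a → a ∈ xs) where

    map-involution-↭ : map σ xs ↭ xs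
    map-involution-↭ = ∼bag⇒↭ (unique∧set⇒bag
      (Unique.map⁺ σ-injective xs-unique) xs-unique
      (λ {a} → mk⇔ (λ _ → xs-complete a) (λ _ → subst (_∈ map σ xs) (σ-involutive a) (∈-map⁺ σ (xs-complete (σ a))))))
      where
      σ-injective : ∀ {a b} → σ a ≡ σ b → a ≡ b
      σ-injective {a} {b} σa≡σb = ≡.trans (≡.sym (σ-involutive a)) (≡.trans (cong σ σa≡σb) (σ-involutive b))

    countᵇ-∘-involution : ∀ (p : A → Bool) → countᵇ (p ∘ σ) xs ≡ countᵇ p xs
    countᵇ-∘-involution p = ≡.trans (≡.sym (countᵇ-map p σ xs)) (countᵇ-↭ p map-involution-↭)

    countᵇ-≤-by-involution : ∀ {p q : A → Bool} →
      (∀ {a} → T (p a) → ¬ T (q a) → T (q (σ a)) × ¬ T (p (σ a))) → countᵇ p xs ≤ countᵇ q xs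
    countᵇ-≤-by-involution {p} {q} trade = begin
      countᵇ p xs                                ≡⟨ countᵇ-partition p q xs ⟩
      countᵇ (λ a → p a ∧ q a) xs + countᵇ (λ a → p a ∧ not (q a)) xs
        ≤⟨ +-mono-≤ (countᵇ-mono (λ {a} → subst T (∧-comm (p a) (q a))) xs) (countᵇ-mono trade′ xs) ⟩
      countᵇ (λ a → q a ∧ p a) xs + countᵇ ((λ a → q a ∧ not (p a)) ∘ σ) xs
        ≡⟨ cong (_ +_) (countᵇ-∘-involution (λ a → q a ∧ not (p a))) ⟩
      countᵇ (λ a → q a ∧ p a) xs + countᵇ (λ a → q a ∧ not (p a)) xs
        ≡⟨ ≡.sym (countᵇ-partition q p xs) ⟩
      countᵇ q xs                                ∎
      where
      open ≤-Reasoning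
      trade′ : ∀ {a} → T (p a ∧ not (q a)) → T (q (σ a) ∧ not (p (σ a)))
      trade′ t with to T-∧ t
      ... | pa , ¬qa with trade pa (to T-not ¬qa)
      ...   | qσa , ¬pσa = from T-∧ (qσa , from T-not ¬pσa)

∈-allSubsets : ∀ {n} (S : Subset n) → S ∈ allSubsets n
∈-allSubsets []          = here refl
∈-allSubsets {suc n} (true  ∷ S) = ∈-++⁺ˡ (∈-map⁺ (true ∷_) (∈-allSubsets S))
∈-allSubsets {suc n} (false ∷ S) = ∈-++⁺ʳ (map (true ∷_) (allSubsets n)) (∈-map⁺ (false ∷_) (∈-allSubsets S))

allSubsets-unique : ∀ n → Unique (allSubsets n)
allSubsets-unique zero    = All.[] AllPairs.∷ AllPairs.[]
allSubsets-unique (suc n) = Unique.++⁺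
  (Unique.map⁺ ∷-injectiveʳ (allSubsets-unique n))
  (Unique.map⁺ ∷-injectiveʳ (allSubsets-unique n))
  disjoint
  where
  disjoint : ∀ {S} → ¬ (S ∈ map (true ∷_) (allSubsets n) × S ∈ map (false ∷_) (allSubsets n))
  disjoint (S∈ , S∈′) with ∈-map⁻ (true ∷_) S∈ | ∈-map⁻ (false ∷_) S∈′
  ... | _ , _ , refl | _ , _ , ()

module _ {A : Set} {n : ℕ} where

  lookup-extensionality : ∀ {u v : Vec A n} → (∀ k → lookup u k ≡ lookup v k) → u ≡ v
  lookup-extensionality {u} {v} u≗v = begin
    u                  ≡⟨ ≡.sym (tabulate∘lookup u) ⟩
    tabulate (lookup u) ≡⟨ tabulate-cong u≗v ⟩
    tabulate (lookup v) ≡⟨ tabulate∘lookup v ⟩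
    v                  ∎
    where open ≡-Reasoning

  exchange : Fin n → Fin n → Vec A n → Vec A n
  exchange i j v = v [ i ]≔ lookup v j [ j ]≔ lookup v i

  module _ {i j : Fin n} (i≢j : i ≢ j) (v : Vec A n) where

    lookup∘exchangeˡ : lookup (exchange i j v) i ≡ lookup v j
    lookup∘exchangeˡ =
      ≡.trans (lookup∘update′ i≢j (v [ i ]≔ lookup v j) (lookup v i)) (lookup∘update i v (lookup v j))

    lookup∘exchangeʳ : lookup (exchange i j v) j ≡ lookup v i
    lookup∘exchangeʳ = lookup∘update j (v [ i ]≔ lookup v j) (lookup v i)

    lookup∘exchange′ : ∀ {k} → k ≢ i → k ≢ j → lookup (exchange i j v) k ≡ lookup v k
    lookup∘exchange′ k≢i k≢j =
      ≡.trans (lookup∘update′ k≢j (v [ i ]≔ lookup v j) (lookup v i)) (lookup∘update′ k≢i v (lookup v j))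

  exchange-involutive : ∀ {i j : Fin n} → i ≢ j → ∀ v → exchange i j (exchange i j v) ≡ v
  exchange-involutive {i} {j} i≢j v = lookup-extensionality same
    where
    w = exchange i j v
    same : ∀ k → lookup (exchange i j w) k ≡ lookup v k
    same k with k ≟ i | k ≟ j
    ... | yes refl | _        = ≡.trans (lookup∘exchangeˡ i≢j w) (lookup∘exchangeʳ i≢j v)
    ... | no _     | yes refl = ≡.trans (lookup∘exchangeʳ i≢j w) (lookup∘exchangeˡ i≢j v)
    ... | no k≢i   | no k≢j   = ≡.trans (lookup∘exchange′ i≢j w k≢i k≢j) (lookup∘exchange′ i≢j v k≢i k≢j)

∣p[i]≔true∣≡1+∣p∣ : ∀ {n} (p : Subset n) {i} → ¬ T (lookup p i) → ∣ p [ i ]≔ true ∣ ≡ suc ∣ p ∣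
∣p[i]≔true∣≡1+∣p∣ (true  ∷ p) {zero}  i∉p = ⊥-elim (i∉p tt)
∣p[i]≔true∣≡1+∣p∣ (false ∷ p) {zero}  i∉p = refl
∣p[i]≔true∣≡1+∣p∣ (true  ∷ p) {suc i} i∉p = cong suc (∣p[i]≔true∣≡1+∣p∣ p i∉p)
∣p[i]≔true∣≡1+∣p∣ (false ∷ p) {suc i} i∉p = ∣p[i]≔true∣≡1+∣p∣ p i∉p

1+∣p[i]≔false∣≡∣p∣ : ∀ {n} (p : Subset n) {i} → T (lookup p i) → suc ∣ p [ i ]≔ false ∣ ≡ ∣ p ∣
1+∣p[i]≔false∣≡∣p∣ (true  ∷ p) {zero}  i∈p = refl
1+∣p[i]≔false∣≡∣p∣ (true  ∷ p) {suc i} i∈p = cong suc (1+∣p[i]≔false∣≡∣p∣ p i∈p)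
1+∣p[i]≔false∣≡∣p∣ (false ∷ p) {suc i} i∈p = 1+∣p[i]≔false∣≡∣p∣ p i∈p

∣exchange∣ : ∀ {n} {i j : Fin n} → i ≢ j → (p : Subset n) → T (lookup p i) → ¬ T (lookup p j) →
  ∣ exchange i j p ∣ ≡ ∣ p ∣
∣exchange∣ {i = i} {j} i≢j p i∈p j∉p = begin
  ∣ p [ i ]≔ lookup p j [ j ]≔ lookup p i ∣
    ≡⟨ cong₂ (λ a b → ∣ p [ i ]≔ a [ j ]≔ b ∣) (to T-not-≡ (from T-not j∉p)) (to T-≡ i∈p) ⟩
  ∣ p [ i ]≔ false [ j ]≔ true ∣ ≡⟨ ∣p[i]≔true∣≡1+∣p∣ (p [ i ]≔ false) j∉p′ ⟩
  suc ∣ p [ i ]≔ false ∣          ≡⟨ 1+∣p[i]≔false∣≡∣p∣ p i∈p ⟩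
  ∣ p ∣                           ∎
  where
  open ≡-Reasoning
  j∉p′ : ¬ T (lookup (p [ i ]≔ false) j)
  j∉p′ = subst (¬_ ∘ T) (≡.sym (lookup∘update′ (i≢j ∘ ≡.sym) p false)) j∉p

T-allᵇ : ∀ {A : Set} {p : A → Bool} xs → T (allᵇ p xs) ⇔ (∀ {a} → a ∈ xs → T (p a))
T-allᵇ {p = p} xs = mk⇔ (sound xs) (complete xs)
  where
  sound : ∀ xs → T (allᵇ p xs) → ∀ {a} → a ∈ xs → T (p a)
  sound (x ∷ xs) t (here refl) = proj₁ (to T-∧ t)
  sound (x ∷ xs) t (there a∈xs) = sound xs (proj₂ (to T-∧ t)) a∈xs
  complete : ∀ xs → (∀ {a} → a ∈ xs → T (p a)) → T (allᵇ p xs)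
  complete []       _   = tt
  complete (x ∷ xs) all = from T-∧ (all (here refl) , complete xs (all ∘ there))

T-allᵇ-allFin : ∀ {n} {p : Fin n → Bool} → T (allᵇ p (allFin n)) ⇔ (∀ i → T (p i))
T-allᵇ-allFin {n} = mk⇔
  (λ t i → to (T-allᵇ (allFin n)) t (∈-allFin i))
  (λ all → from (T-allᵇ (allFin n)) (λ {i} _ → all i))

T-implication : ∀ {a b e c} → T (not (a ∧ b) ∨ e ∨ c) ⇔ (T a → T b → ¬ T e → T c)
T-implication {false}               = mk⇔ (λ _ ()) (λ _ → tt)
T-implication {true} {false}        = mk⇔ (λ _ _ ()) (λ _ → tt)
T-implication {true} {true} {true}  = mk⇔ (λ _ _ _ ¬e → ⊥-elim (¬e tt)) (λ _ → tt)
T-implication {true} {true} {false} = mk⇔ (λ c _ _ _ → c) (λ imp → imp tt tt (λ ()))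

T-== : ∀ {n} {i j : Fin n} → T (i == j) ⇔ i ≡ j
T-== = mk⇔ toWitness fromWitness

module _ {n : ℕ} where

  Complete : Adj n → Subset n → Set
  Complete A S = ∀ {i j} → T (lookup S i) → T (lookup S j) → i ≢ j → T (A i j)

  IsClique : ℕ → Adj n → Subset n → Set
  IsClique s A S = ∣ S ∣ ≡ s × Complete A S

  T-isCliqueᵇ : ∀ s A S → T (isCliqueᵇ s A S) ⇔ IsClique s A S
  T-isCliqueᵇ s A S = mk⇔ sound complete
    where
    edge : Fin n → Fin n → Bool
    edge i j = not (lookup S i ∧ lookup S j) ∨ (i == j) ∨ A i j

    T-edge : ∀ {i j} → T (edge i j) ⇔ (T (lookup S i) → T (lookup S j) → i ≢ j → T (A i j))
    T-edge {i} {j} = mk⇔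
      (λ t i∈S j∈S i≢j → to (T-implication {lookup S i}) t i∈S j∈S (i≢j ∘ to T-==))
      (λ imp → from (T-implication {lookup S i}) (λ i∈S j∈S ¬i=j → imp i∈S j∈S (¬i=j ∘ from T-==)))

    T-edges : T (allᵇ (λ i → allᵇ (edge i) (allFin n)) (allFin n)) ⇔ Complete A S
    T-edges = mk⇔
      (λ t {i} {j} → to T-edge (to T-allᵇ-allFin (to T-allᵇ-allFin t i) j))
      (λ c → from T-allᵇ-allFin λ i → from T-allᵇ-allFin λ j → from (T-edge {i} {j}) c)

    sound : T (isCliqueᵇ s A S) → IsClique s A S
    sound t with to T-∧ t
    ... | size , edges = ≡ᵇ⇒≡ ∣ S ∣ s size , to T-edges edges

    complete : IsClique s A S → T (isCliqueᵇ s A S)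
    complete (size , c) = from T-∧ (≡⇒≡ᵇ ∣ S ∣ s size , from T-edges c)

isClique-mono : ∀ {n s} {A B : Adj n} {S} → (∀ {i j} → T (A i j) → T (B i j)) → IsClique s A S → IsClique s B S
isClique-mono A⊆B (size , c) = size , λ i∈S j∈S i≢j → A⊆B (c i∈S j∈S i≢j)

numCliques-mono : ∀ {n s} {A B : Adj n} → (∀ {i j} → T (A i j) → T (B i j)) → numCliques s A ≤ numCliques s B
numCliques-mono {n} {s} {A} {B} A⊆B = countᵇ-mono {p = isCliqueᵇ s A} {q = isCliqueᵇ s B}
  (λ {S} → from (T-isCliqueᵇ s B S) ∘ isClique-mono {S = S} A⊆B ∘ to (T-isCliqueᵇ s A S)) (allSubsets n)

numCliques-≤-extension : ∀ {n s} {A : Adj n} {B : Adj (suc n)} →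
  (∀ {i j} → T (A i j) → T (B (suc i) (suc j))) → numCliques s A ≤ numCliques s B
numCliques-≤-extension {n} {s} {A} {B} A⊆B = begin
  countᵇ (isCliqueᵇ s A) (allSubsets n)
    ≤⟨ countᵇ-mono {p = isCliqueᵇ s A} {q = isCliqueᵇ s B ∘ (false ∷_)}
         (λ {S} → from (T-isCliqueᵇ s B (false ∷ S)) ∘ extend ∘ to (T-isCliqueᵇ s A S)) (allSubsets n) ⟩
  countᵇ (isCliqueᵇ s B ∘ (false ∷_)) (allSubsets n)
    ≡⟨ ≡.sym (countᵇ-map (isCliqueᵇ s B) (false ∷_) (allSubsets n)) ⟩
  countᵇ (isCliqueᵇ s B) (map (false ∷_) (allSubsets n))
    ≤⟨ countᵇ-++ʳ (isCliqueᵇ s B) (map (true ∷_) (allSubsets n)) _ ⟩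
  countᵇ (isCliqueᵇ s B) (allSubsets (suc n))             ∎
  where
  open ≤-Reasoning
  extend-complete : ∀ {S} → Complete A S → Complete B (false ∷ S)
  extend-complete c {suc i} {suc j} i∈S j∈S i≢j = A⊆B (c i∈S j∈S (i≢j ∘ cong suc))

  extend : ∀ {S} → IsClique s A S → IsClique s B (false ∷ S)
  extend (size , c) = size , extend-complete c

module Kelmans {n : ℕ} (G : SimpleGraph n) {x y : Fin n} (x≢y : x ≢ y) where

  K : Adj n
  K = kelmans G x y

  moves : Fin n → Bool
  moves w = adj G w x ∧ not (w == y) ∧ not (adj G w y)

  T-moves : ∀ {w} → T (moves w) ⇔ (T (adj G w x) × w ≢ y × ¬ T (adj G w y))
  T-moves = mk⇔
    (λ t → let (wx , r) = to T-∧ t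
               (w≠y , ¬wy) = to T-∧ r
           in wx , to T-not w≠y ∘ from T-== , to T-not ¬wy)
    (λ (wx , w≢y , ¬wy) → from T-∧ (wx , from T-∧ (from T-not (w≢y ∘ to T-==) , from T-not ¬wy)))

  kept : Fin n → Fin n → Bool
  kept a b = adj G a b ∧ not (((a == x) ∧ moves b) ∨ ((b == x) ∧ moves a))

  kelmans-sym : ∀ a b → K a b ≡ K b a
  kelmans-sym a b = cong₂ _∨_
    (cong₂ _∧_ (sym G a b) (cong not (∨-comm ((a == x) ∧ moves b) ((b == x) ∧ moves a))))
    (∨-comm ((a == y) ∧ moves b) ((b == y) ∧ moves a))

  kelmans-keeps : ∀ {a b} → T (adj G a b) → ¬ T ((a == x) ∧ moves b) → ¬ T ((b == x) ∧ moves a) → T (K a b)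
  kelmans-keeps ab m₁ m₂ = from T-∨ (inj₁ (from T-∧ (ab , from T-not ([ m₁ , m₂ ] ∘ to T-∨))))

  kelmans-keeps-away : ∀ {a b} → a ≢ x → b ≢ x → T (adj G a b) → T (K a b)
  kelmans-keeps-away a≢x b≢x ab =
    kelmans-keeps ab (a≢x ∘ to T-== ∘ proj₁ ∘ to T-∧) (b≢x ∘ to T-== ∘ proj₁ ∘ to T-∧)

  kelmans-gains : ∀ {b} → T (moves b) → T (K y b)
  kelmans-gains {b} m = from (T-∨ {kept y b}) (inj₂ (from (T-∨ {(y == y) ∧ moves b} {(b == y) ∧ moves y})
    (inj₁ (from T-∧ (from (T-== {i = y}) refl , m)))))

  module _ (S : Subset n) (complete : Complete (adj G) S) where

    kelmans-complete : (¬ T (lookup S x) ⊎ (∀ {w} → T (lookup S w) → ¬ T (moves w))) → Complete K S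
    kelmans-complete x∉S⊎still i∈S j∈S i≢j =
      kelmans-keeps (complete i∈S j∈S i≢j) (stays i∈S j∈S) (stays j∈S i∈S)
      where
      stays : ∀ {a b} → T (lookup S a) → T (lookup S b) → ¬ T ((a == x) ∧ moves b)
      stays a∈S b∈S t with to T-∧ t
      ... | a=x , mb =
        [ (λ x∉S → x∉S (subst (T ∘ lookup S) (to T-== a=x) a∈S)) , (λ still → still b∈S mb) ] x∉S⊎still

    moving-member⇒y∉S : ∀ {w} → T (lookup S w) → T (moves w) → ¬ T (lookup S y)
    moving-member⇒y∉S w∈S mw y∈S with to T-moves mw
    ... | _ , w≢y , ¬wy = ¬wy (complete w∈S y∈S w≢y)

    module _ (x∈S : T (lookup S x)) (y∉S : ¬ T (lookup S y)) where

      y∈exchange : T (lookup (exchange x y S) y)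
      y∈exchange = subst T (≡.sym (lookup∘exchangeʳ x≢y S)) x∈S

      exchange-member⁻ : ∀ {k} → T (lookup (exchange x y S) k) → k ≢ y → k ≢ x × T (lookup S k)
      exchange-member⁻ {k} k∈S′ k≢y = k≢x , subst T (lookup∘exchange′ x≢y S k≢x k≢y) k∈S′
        where
        k≢x : k ≢ x
        k≢x refl = y∉S (subst T (lookup∘exchangeˡ x≢y S) k∈S′)

      y-adjacent : ∀ {j} → T (lookup S j) → j ≢ x → j ≢ y → T (K y j)
      y-adjacent {j} j∈S j≢x j≢y with T? (adj G y j)
      ... | yes yj = kelmans-keeps-away (x≢y ∘ ≡.sym) j≢x yj
      ... | no ¬yj = kelmans-gains (from T-moves (complete j∈S x∈S j≢x , j≢y , ¬yj ∘ subst T (sym G j y)))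

      exchange-complete : Complete K (exchange x y S)
      exchange-complete {i} {j} i∈S′ j∈S′ i≢j = by-cases (i ≟ y) (j ≟ y)
        where
        by-cases : Dec (i ≡ y) → Dec (j ≡ y) → T (K i j)
        by-cases (yes i≡y) (yes j≡y) = ⊥-elim (i≢j (≡.trans i≡y (≡.sym j≡y)))
        by-cases (yes i≡y) (no j≢y)  = let (j≢x , j∈S) = exchange-member⁻ j∈S′ j≢y in
          subst (λ k → T (K k j)) (≡.sym i≡y) (y-adjacent j∈S j≢x j≢y)
        by-cases (no i≢y)  (yes j≡y) = let (i≢x , i∈S) = exchange-member⁻ i∈S′ i≢y in
          subst (λ k → T (K i k)) (≡.sym j≡y) (subst T (kelmans-sym y i) (y-adjacent i∈S i≢x i≢y))
        by-cases (no i≢y)  (no j≢y)  = let (i≢x , i∈S) = exchange-member⁻ i∈S′ i≢y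
                                           (j≢x , j∈S) = exchange-member⁻ j∈S′ j≢y in
          kelmans-keeps-away i≢x j≢x (complete i∈S j∈S i≢j)

      exchange-incomplete : ∀ {w} → T (lookup S w) → T (moves w) → ¬ Complete (adj G) (exchange x y S)
      exchange-incomplete {w} w∈S mw complete′ with to T-moves mw
      ... | wx , w≢y , ¬wy = ¬wy (complete′ w∈S′ y∈exchange w≢y)
        where
        w≢x : w ≢ x
        w≢x refl = subst T (loopless G w) wx
        w∈S′ : T (lookup (exchange x y S) w)
        w∈S′ = subst T (≡.sym (lookup∘exchange′ x≢y S w≢x w≢y)) w∈S

  kelmans-clique-exchange : ∀ {s S} → IsClique s (adj G) S → ¬ IsClique s K S →
    IsClique s K (exchange x y S) × ¬ IsClique s (adj G) (exchange x y S)
  kelmans-clique-exchange {s} {S} (size , c) ¬clique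
    with T? (lookup S x) | any? (λ w → T? (lookup S w ∧ moves w))
  ... | no x∉S  | _      = ⊥-elim (¬clique (size , kelmans-complete S c (inj₁ x∉S)))
  ... | yes _   | no ∄   =
    ⊥-elim (¬clique (size , kelmans-complete S c (inj₂ λ w∈S mw → ∄ (_ , from T-∧ (w∈S , mw)))))
  ... | yes x∈S | yes (w , t) with to T-∧ t
  ...   | w∈S , mw =
    (≡.trans (∣exchange∣ x≢y S x∈S y∉S) size , exchange-complete S c x∈S y∉S) ,
    (λ (_ , c′) → exchange-incomplete S c x∈S y∉S w∈S mw c′)
    where
    y∉S = moving-member⇒y∉S S c w∈S mw

  numCliques-≤-kelmans : ∀ s → numCliques s (adj G) ≤ numCliques s K
  numCliques-≤-kelmans s =
    countᵇ-≤-by-involution {σ = exchange x y} (exchange-involutive x≢y) (allSubsets-unique n) ∈-allSubsets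
      (λ {S} → trade S)
    where
    trade : ∀ S → T (isCliqueᵇ s (adj G) S) → ¬ T (isCliqueᵇ s K S) →
      T (isCliqueᵇ s K (exchange x y S)) × ¬ T (isCliqueᵇ s (adj G) (exchange x y S))
    trade S inG ¬inK =
      let (inK′ , ¬inG′) = kelmans-clique-exchange {S = S} (to (T-isCliqueᵇ s (adj G) S) inG)
                                                             (¬inK ∘ from (T-isCliqueᵇ s K S))
      in from (T-isCliqueᵇ s K (exchange x y S)) inK′ , ¬inG′ ∘ to (T-isCliqueᵇ s (adj G) (exchange x y S))

mainTheorem7 : (s : ℕ) → 1 ≤ s → (n : ℕ) → (G : SimpleGraph n) → Connected G →
    ((u v : Fin n) → u ≢ v → numCliques s (adj G) ≤ numCliques s (kelmans G u v))
    × ((u v : Fin n) → u ≢ v → adj G u v ≡ false → numCliques s (adj G) ≤ numCliques s (addEdge G u v))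
    × ((u : Fin n) → numCliques s (adj G) ≤ numCliques s (addPendant G u))
mainTheorem7 s _ n G _ =
    (λ u v u≢v → Kelmans.numCliques-≤-kelmans G u≢v s)
  , (λ u v _ _ → numCliques-mono {A = adj G} {addEdge G u v} (λ uv → from T-∨ (inj₁ uv)))
  , (λ u → numCliques-≤-extension {A = adj G} {addPendant G u} (λ uv → uv))
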